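{- There is an absolute constant $C>0$ such that the following holds. Let $n \ge 1$ be an integer and $q \ge 2n$ a prime power. Then there is a partition $\{A^i\}_{i=1}^N$ of $(\mathbb{F}_q P^n)^n$ such that (1) each part is a product set $A^i = \prod_{j=1}^n A^i_j$ with $A^i_j \subseteq \mathbb{F}_q P^n$, and (2) for each $i$ there is an $(n-1)$-dimensional flat $L^i \subseteq \mathbb{F}_q P^n$ with $A^i \subseteq (L^i)^n$, and whose number of parts satisfies $N \le q^{n(n+1)/2}\,(1 + C n/q)$.
   Context: $\mathbb{F}_q P^n$ denotes the $n$-dimensional projective space over the finite field $\mathbb{F}_q$: its points are the $1$-dimensional linear subspaces of $\mathbb{F}_q^{n+1}$. A flat of $\mathbb{F}_q P^n$ is the set of points contained in a linear subspace $U$ of $\mathbb{F}_q^{n+1}$, and its dimension is $\dim U - 1$. -}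

module Defs where

open import Level using (0ℓ)
open import Data.Nat as ℕ using (ℕ; zero; suc)
open import Data.Nat.Primality using (Prime)
open import Data.Fin using (Fin; zero; suc)
open import Data.Vec using (Vec; []; _∷_; replicate; zipWith; map)
open import Data.Bool using (Bool; true; false; T)
open import Data.Product using (Σ; ∃; ∃-syntax; _×_; _,_; proj₁)
open import Relation.Nullary using (¬_; Dec; yes; no; does)
open import Relation.Binary.PropositionalEquality using (_≡_)
open import Algebra.Structures using (IsCommutativeRing)
open import Function.Bundles using (_↔_)

IsPrimePower : ℕ → Set
IsPrimePower q = ∃[ p ] ∃[ k ] (Prime p × 1 ℕ.≤ k × q ≡ p ℕ.^ k)

record FiniteField (q : ℕ) : Set₁ where
  infixl 6 _+_
  infixl 7 _*_
  field
    Carrier : Set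
    _+_ _*_ : Carrier → Carrier → Carrier
    -_      : Carrier → Carrier
    0# 1#   : Carrier
    isCommutativeRing : IsCommutativeRing _≡_ _+_ _*_ -_ 0# 1#
    0≢1     : ¬ (0# ≡ 1#)
    inverse : ∀ x → ¬ (x ≡ 0#) → ∃[ y ] (x * y ≡ 1#)
    _≟_     : (x y : Carrier) → Dec (x ≡ y)
    card    : Carrier ↔ Fin q

module _ {q : ℕ} (F : FiniteField q) where
  open FiniteField F

  -- canonical representative of a projective point: first nonzero coordinate is 1
  normalized : ∀ {m} → Vec Carrier m → Bool
  normalized [] = false
  normalized (x ∷ xs) with x ≟ 0#
  ... | yes _ = normalized xs
  ... | no  _ = does (x ≟ 1#)

  -- points of F_q P^n: 1-dim subspaces of F_q^(n+1), via their normalized spanning vector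
  Point : ℕ → Set
  Point n = Σ (Vec Carrier (suc n)) (λ v → T (normalized v))

  lincomb : ∀ {k m} → (Fin k → Carrier) → (Fin k → Vec Carrier m) → Vec Carrier m
  lincomb {zero}  c u = replicate _ 0#
  lincomb {suc k} c u =
    zipWith _+_ (map (c zero *_) (u zero)) (lincomb (λ i → c (suc i)) (λ i → u (suc i)))

  LinearlyIndependent : ∀ {k m} → (Fin k → Vec Carrier m) → Set
  LinearlyIndependent {k} {m} u =
    (c : Fin k → Carrier) → lincomb c u ≡ replicate m 0# → (i : Fin k) → c i ≡ 0#

  record Subspace (m k : ℕ) : Set where
    field
      basis : Fin k → Vec Carrier m
      indep : LinearlyIndependent basis

  -- a flat of dimension d in F_q P^n: a linear subspace of F^(n+1) of dimension d+1
  Flat : ℕ → ℕ → Set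
  Flat n d = Subspace (suc n) (suc d)

  _∈Flat_ : ∀ {n d} → Point n → Flat n d → Set
  p ∈Flat L = ∃[ c ] (proj₁ p ≡ lincomb c (Subspace.basis L))

-- Fix the first coordinate x₀ of a tuple in (F_q P^n)^n, project the other n − 1
-- coordinates from x₀ onto F_q P^(n−1), and classify them by the partition of (F_q P^(n−1))^(n−1)
-- already built; a hyperplane H of F_q P^(n−1) then lifts to the hyperplane spanned by x₀ and H,
-- which contains x₀ and every point projecting into H. The number of parts is therefore
-- N_n = |F_q P^n| · N_(n−1) = ∏_(1≤k≤n) (q^(k+1) − 1)/(q − 1) ≤ q^(n(n+1)/2) (1 + 1/(q−1))^n,
-- and (1 + 1/r)^n ≤ 1 + 2n/r ≤ 1 + 4n/q for r = q − 1 ≥ 2n − 1.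

module Submission where

open import Defs
import Data.Nat as Nat
open import Data.Nat using (ℕ; zero; suc; s≤s; z≤n)
open import Data.Fin using (Fin; zero; suc)
open import Data.Vec using (Vec; []; _∷_; head; tail; replicate; zipWith; map)
open import Data.Product using (Σ; ∃-syntax; _×_; _,_; proj₁; proj₂)
open import Data.Sum using (_⊎_; inj₁; inj₂)
open import Data.Bool using (T)
open import Data.Bool.Properties using (T-irrelevant)
open import Data.Empty using (⊥-elim)
open import Data.Unit using (tt)
open import Relation.Nullary using (yes; no; does)
open import Relation.Binary.PropositionalEquality
open import Algebra.Bundles using (CommutativeRing)
open import Data.Vec.Properties using (zipWith-identityˡ; zipWith-identityʳ; map-replicate)
import Data.Vec.Functional as Coefficients
open import Function.Bundles using (_↔_; _↪_; mk↪; Inverse; RightInverse)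
open import Function.Properties.Inverse using (↔-sym; ↔⇒↪)
open import Function.Construct.Composition using (_↔-∘_; _↪-∘_)
open import Data.Sum.Function.Propositional using (_⊎-↪_)
open import Data.Fin.Properties using (+↔⊎; *↔×)
open import Data.Vec.Recursive using (lift↔; Fin[m^n]↔Fin[m]^n)
open import Data.Vec.Recursive.Properties using (↔Vec)

module Counting where
  open import Data.Nat
  open import Data.Nat.Properties
  open import Data.Nat.DivMod using (_/_; m*n/n≡m)
  open import Data.Nat.Tactic.RingSolver using (solve-∀)

  pointCount : ℕ → ℕ → ℕ
  pointCount q zero    = 1
  pointCount q (suc k) = q ^ suc k + pointCount q k

  partCount : ℕ → ℕ → ℕ
  partCount q zero    = 1
  partCount q (suc m) = pointCount q (suc m) * partCount q m

  triangular : ℕ → ℕ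
  triangular zero    = 0
  triangular (suc n) = suc n + triangular n

  triangular*2≡n*[n+1] : ∀ n → triangular n * 2 ≡ n * (n + 1)
  triangular*2≡n*[n+1] zero    = refl
  triangular*2≡n*[n+1] (suc n) = begin
    (suc n + triangular n) * 2     ≡⟨ *-distribʳ-+ 2 (suc n) (triangular n) ⟩
    suc n * 2 + triangular n * 2   ≡⟨ cong (suc n * 2 +_) (triangular*2≡n*[n+1] n) ⟩
    suc n * 2 + n * (n + 1)        ≡⟨ step n ⟩
    suc n * (suc n + 1)            ∎
    where
    open ≡-Reasoning
    step : ∀ n → suc n * 2 + n * (n + 1) ≡ suc n * (suc n + 1)
    step = solve-∀

  n*[n+1]/2≡triangular : ∀ n → n * (n + 1) / 2 ≡ triangular n
  n*[n+1]/2≡triangular n =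
    trans (cong (_/ 2) (sym (triangular*2≡n*[n+1] n))) (m*n/n≡m (triangular n) 2)

  pointCount*r<[1+r]^[1+k] : ∀ r k → pointCount (suc r) k * r < suc r ^ suc k
  pointCount*r<[1+r]^[1+k] r zero    =
    ≤-reflexive (trans (cong suc (*-identityˡ r)) (sym (*-identityʳ (suc r))))
  pointCount*r<[1+r]^[1+k] r (suc k) = begin-strict
    (Q + pointCount q k) * r       ≡⟨ *-distribʳ-+ r Q (pointCount q k) ⟩
    Q * r + pointCount q k * r     <⟨ +-monoʳ-< (Q * r) (pointCount*r<[1+r]^[1+k] r k) ⟩
    Q * r + Q                      ≡⟨ +-comm (Q * r) Q ⟩
    Q + Q * r                      ≡⟨ sym (*-suc Q r) ⟩
    Q * q                          ≡⟨ *-comm Q q ⟩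
    q * Q                          ∎
    where
    open ≤-Reasoning
    q = suc r
    Q = q ^ suc k

  partCount*r^n≤[1+r]^[triangular+n] : ∀ r n → partCount (suc r) n * r ^ n ≤ suc r ^ (triangular n + n)
  partCount*r^n≤[1+r]^[triangular+n] r zero    = ≤-refl
  partCount*r^n≤[1+r]^[triangular+n] r (suc n) = begin
    pointCount q (suc n) * partCount q n * (r * r ^ n)
      ≡⟨ interchange (pointCount q (suc n)) (partCount q n) r (r ^ n) ⟩
    (pointCount q (suc n) * r) * (partCount q n * r ^ n)
      ≤⟨ *-mono-≤ (<⇒≤ (pointCount*r<[1+r]^[1+k] r (suc n))) (partCount*r^n≤[1+r]^[triangular+n] r n) ⟩
    q ^ (2 + n) * q ^ (triangular n + n)
      ≡⟨ sym (^-distribˡ-+-* q (2 + n) (triangular n + n)) ⟩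
    q ^ (2 + n + (triangular n + n))
      ≡⟨ cong (q ^_) (exponent n (triangular n)) ⟩
    q ^ (triangular (suc n) + suc n) ∎
    where
    open ≤-Reasoning
    q = suc r
    interchange : ∀ a b c d → a * b * (c * d) ≡ (a * c) * (b * d)
    interchange = solve-∀
    exponent : ∀ n t → 2 + n + (t + n) ≡ suc n + t + suc n
    exponent = solve-∀

  -- (1 + 1/r)^j ≤ 1 + 2j/r, cleared of denominators
  r*[1+r]^j≤r^j*[r+2j] : ∀ r j → 2 * j ≤ suc r → r * suc r ^ j ≤ r ^ j * (r + 2 * j)
  r*[1+r]^j≤r^j*[r+2j] r zero    _   =
    ≤-reflexive (trans (*-identityʳ r) (sym (trans (*-identityˡ (r + 0)) (+-identityʳ r))))
  r*[1+r]^j≤r^j*[r+2j] r (suc j) 2j+2≤r+1 = begin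
    r * (q * q ^ j)                   ≡⟨ x*[y*z]≡y*[x*z] r q (q ^ j) ⟩
    q * (r * q ^ j)                   ≤⟨ *-monoʳ-≤ q (r*[1+r]^j≤r^j*[r+2j] r j (≤-trans 2j≤r (n≤1+n r))) ⟩
    q * (r ^ j * (r + 2 * j))         ≡⟨ x*[y*z]≡y*[x*z] q (r ^ j) (r + 2 * j) ⟩
    r ^ j * (q * (r + 2 * j))         ≤⟨ *-monoʳ-≤ (r ^ j) step ⟩
    r ^ j * (r * (r + 2 * suc j))     ≡⟨ sym (x*[y*z]≡y*[x*z] r (r ^ j) (r + 2 * suc j)) ⟩
    r * (r ^ j * (r + 2 * suc j))     ≡⟨ sym (*-assoc r (r ^ j) (r + 2 * suc j)) ⟩
    r * r ^ j * (r + 2 * suc j)       ∎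
    where
    open ≤-Reasoning
    q = suc r
    x*[y*z]≡y*[x*z] : ∀ x y z → x * (y * z) ≡ y * (x * z)
    x*[y*z]≡y*[x*z] = solve-∀
    2j≤r : 2 * j ≤ r
    2j≤r = <⇒≤ (≤-pred (subst (_≤ q) (*-suc 2 j) 2j+2≤r+1))
    step : q * (r + 2 * j) ≤ r * (r + 2 * suc j)
    step = begin
      q * (r + 2 * j)               ≡⟨ +-comm (r + 2 * j) (r * (r + 2 * j)) ⟩
      r * (r + 2 * j) + (r + 2 * j) ≤⟨ +-monoʳ-≤ (r * (r + 2 * j)) (+-monoʳ-≤ r 2j≤r) ⟩
      r * (r + 2 * j) + (r + r)     ≡⟨ regroup r j ⟩
      r * (r + 2 * suc j)           ∎
      where
      regroup : ∀ r j → r * (r + 2 * j) + (r + r) ≡ r * (r + 2 * suc j)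
      regroup = solve-∀

  [1+r]*[r+2n]≤r*[1+r+4n] : ∀ r n → 1 ≤ r → suc r * (r + 2 * n) ≤ r * (suc r + 4 * n)
  [1+r]*[r+2n]≤r*[1+r+4n] r n 1≤r = begin
    suc r * (r + 2 * n)                ≡⟨ left r n ⟩
    r * (r + 2 * n) + (r + 2 * n * 1)
      ≤⟨ +-monoʳ-≤ (r * (r + 2 * n)) (+-monoʳ-≤ r (*-monoʳ-≤ (2 * n) 1≤r)) ⟩
    r * (r + 2 * n) + (r + 2 * n * r)  ≡⟨ right r n ⟩
    r * (suc r + 4 * n)                ∎
    where
    open ≤-Reasoning
    left : ∀ r n → suc r * (r + 2 * n) ≡ r * (r + 2 * n) + (r + 2 * n * 1)
    left = solve-∀
    right : ∀ r n → r * (r + 2 * n) + (r + 2 * n * r) ≡ r * (suc r + 4 * n)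
    right = solve-∀

  partCount-bound : ∀ q n → 2 ≤ q → 2 * n ≤ q → partCount q n * q ≤ q ^ triangular n * (q + 4 * n)
  partCount-bound (suc zero) n (s≤s ()) _
  partCount-bound q@(suc r@(suc _)) n _ 2n≤q = *-cancelˡ-≤ (r ^ n * r) ⦃ r^n*r≢0 ⦄ (begin
    r ^ n * r * (partCount q n * q)
      ≡⟨ rearrange₁ (r ^ n) r (partCount q n) q ⟩
    partCount q n * r ^ n * (q * r)
      ≤⟨ *-monoˡ-≤ (q * r) (partCount*r^n≤[1+r]^[triangular+n] r n) ⟩
    q ^ (triangular n + n) * (q * r)
      ≡⟨ cong (_* (q * r)) (^-distribˡ-+-* q (triangular n) n) ⟩
    q ^ triangular n * q ^ n * (q * r)
      ≡⟨ rearrange₂ (q ^ triangular n) (q ^ n) q r ⟩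
    q ^ triangular n * (q * (r * q ^ n))
      ≤⟨ *-monoʳ-≤ (q ^ triangular n) (*-monoʳ-≤ q (r*[1+r]^j≤r^j*[r+2j] r n 2n≤q)) ⟩
    q ^ triangular n * (q * (r ^ n * (r + 2 * n)))
      ≡⟨ rearrange₃ (q ^ triangular n) q (r ^ n) (r + 2 * n) ⟩
    r ^ n * (q ^ triangular n * (q * (r + 2 * n)))
      ≤⟨ *-monoʳ-≤ (r ^ n) (*-monoʳ-≤ (q ^ triangular n) ([1+r]*[r+2n]≤r*[1+r+4n] r n (s≤s z≤n))) ⟩
    r ^ n * (q ^ triangular n * (r * (q + 4 * n)))
      ≡⟨ rearrange₄ (r ^ n) (q ^ triangular n) r (q + 4 * n) ⟩
    r ^ n * r * (q ^ triangular n * (q + 4 * n)) ∎)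
    where
    open ≤-Reasoning
    r^n*r≢0 : NonZero (r ^ n * r)
    r^n*r≢0 = m*n≢0 (r ^ n) r ⦃ m^n≢0 r n ⦄
    rearrange₁ : ∀ a b c d → a * b * (c * d) ≡ c * a * (d * b)
    rearrange₁ = solve-∀
    rearrange₂ : ∀ a b c d → a * b * (c * d) ≡ a * (c * (d * b))
    rearrange₂ = solve-∀
    rearrange₃ : ∀ a b c d → a * (b * (c * d)) ≡ c * (a * (b * d))
    rearrange₃ = solve-∀
    rearrange₄ : ∀ a b c d → a * (b * (c * d)) ≡ a * c * (b * d)
    rearrange₄ = solve-∀

open Counting using (pointCount; partCount; n*[n+1]/2≡triangular; partCount-bound)

infix 4 _∈Π_
_∈Π_ : {X : Set} {m : ℕ} → (Fin m → X) → (Fin m → X → Set) → Set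
x ∈Π A = ∀ j → A j (x j)

record ProductPartition (I X : Set) (m : ℕ) : Set₁ where
  field
    part     : I → Fin m → X → Set
    classify : (x : Fin m → X) → ∃[ i ] (x ∈Π part i × ∀ i′ → x ∈Π part i′ → i′ ≡ i)

module _ {X : Set} where
  open ProductPartition

  trivialPartition : ProductPartition (Fin 1) X 0
  trivialPartition .part _ ()
  trivialPartition .classify _ = zero , (λ ()) , λ { zero _ → refl }

  reindex : {I J : Set} {m : ℕ} → I ↔ J → ProductPartition I X m → ProductPartition J X m
  reindex I↔J P .part j = P .part (Inverse.from I↔J j)
  reindex I↔J P .classify x =
    let i , x∈i , unique = P .classify x in
    Inverse.to I↔J i ,
    subst (λ i → x ∈Π P .part i) (sym (Inverse.strictlyInverseʳ I↔J i)) x∈i ,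
    λ j x∈j → sym (Inverse.inverseˡ I↔J (sym (unique _ x∈j)))

  extend : {A I Y : Set} {m : ℕ} (f : X → A) (π : A → X → Y) →
           ProductPartition I Y m → ProductPartition (A × I) X (suc m)
  extend f π P .part (a , i) zero    y = f y ≡ a
  extend f π P .part (a , i) (suc j) y = P .part i j (π a y)
  extend f π P .classify x = (a , i) , x∈ , unique
    where
    a = f (x zero)
    tail-classified = P .classify (λ j → π a (x (suc j)))
    i = proj₁ tail-classified
    x∈ : x ∈Π extend f π P .part (a , i)
    x∈ zero    = refl
    x∈ (suc j) = proj₁ (proj₂ tail-classified) j
    unique : ∀ ai′ → x ∈Π extend f π P .part ai′ → ai′ ≡ (a , i)
    unique (a′ , i′) x∈′ with refl ← x∈′ zero =
      cong (a ,_) (proj₂ (proj₂ tail-classified) i′ (λ j → x∈′ (suc j)))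

module _ {q : ℕ} (F : FiniteField q) where
  open FiniteField F

  commutativeRing : CommutativeRing _ _
  commutativeRing = record { isCommutativeRing = isCommutativeRing }

  open CommutativeRing commutativeRing
    using (_-_; +-assoc; +-identityˡ; +-identityʳ; -‿inverseʳ
          ; *-assoc; *-identityˡ; *-identityʳ; distribˡ; distribʳ; zeroˡ; zeroʳ
          ; ring; +-abelianGroup; +-commutativeSemigroup)
  open import Algebra.Properties.Ring ring using (-‿distribʳ-*; -0#≈0#; -‿+-comm)
  open import Algebra.Properties.AbelianGroup +-abelianGroup using (xyx⁻¹≈y)
  open import Algebra.Properties.CommutativeSemigroup +-commutativeSemigroup using (interchange)

  private variable
    k m n : ℕ

  infixl 6 _+ᵛ_ _-ᵛ_
  infixr 7 _·_

  _+ᵛ_ _-ᵛ_ : Vec Carrier m → Vec Carrier m → Vec Carrier m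
  _+ᵛ_ = zipWith _+_
  _-ᵛ_ = zipWith _-_

  _·_ : Carrier → Vec Carrier m → Vec Carrier m
  a · u = map (a *_) u

  0ᵛ : Vec Carrier m
  0ᵛ = replicate _ 0#

  +ᵛ-identityˡ : (u : Vec Carrier m) → 0ᵛ +ᵛ u ≡ u
  +ᵛ-identityˡ = zipWith-identityˡ +-identityˡ

  +ᵛ-identityʳ : (u : Vec Carrier m) → u +ᵛ 0ᵛ ≡ u
  +ᵛ-identityʳ = zipWith-identityʳ +-identityʳ

  ·-zeroʳ : ∀ a → a · 0ᵛ ≡ 0ᵛ {m}
  ·-zeroʳ a = trans (map-replicate (a *_) 0# _) (cong (replicate _) (zeroʳ a))

  ·-zeroˡ : (u : Vec Carrier m) → 0# · u ≡ 0ᵛ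
  ·-zeroˡ []       = refl
  ·-zeroˡ (x ∷ u) = cong₂ _∷_ (zeroˡ x) (·-zeroˡ u)

  ·-identityˡ : (u : Vec Carrier m) → 1# · u ≡ u
  ·-identityˡ []      = refl
  ·-identityˡ (x ∷ u) = cong₂ _∷_ (*-identityˡ x) (·-identityˡ u)

  ·-assoc : ∀ a b (u : Vec Carrier m) → a · b · u ≡ (a * b) · u
  ·-assoc a b []      = refl
  ·-assoc a b (x ∷ u) = cong₂ _∷_ (sym (*-assoc a b x)) (·-assoc a b u)

  ·-distribˡ-+ᵛ : ∀ a (u w : Vec Carrier m) → a · (u +ᵛ w) ≡ a · u +ᵛ a · w
  ·-distribˡ-+ᵛ a []      []      = refl
  ·-distribˡ-+ᵛ a (x ∷ u) (y ∷ w) = cong₂ _∷_ (distribˡ a x y) (·-distribˡ-+ᵛ a u w)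

  -ᵛ-·-additive : ∀ a b (u w x : Vec Carrier m) →
                  (u +ᵛ w) -ᵛ (a + b) · x ≡ (u -ᵛ a · x) +ᵛ (w -ᵛ b · x)
  -ᵛ-·-additive a b []       []       []       = refl
  -ᵛ-·-additive a b (u₀ ∷ u) (w₀ ∷ w) (x₀ ∷ x) =
    cong₂ _∷_ scalar (-ᵛ-·-additive a b u w x)
    where
    open ≡-Reasoning
    scalar : (u₀ + w₀) - (a + b) * x₀ ≡ (u₀ - a * x₀) + (w₀ - b * x₀)
    scalar = begin
      (u₀ + w₀) - (a + b) * x₀           ≡⟨ cong (λ z → (u₀ + w₀) - z) (distribʳ x₀ a b) ⟩
      (u₀ + w₀) - (a * x₀ + b * x₀)      ≡⟨ cong ((u₀ + w₀) +_) (sym (-‿+-comm (a * x₀) (b * x₀))) ⟩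
      (u₀ + w₀) + (- (a * x₀) + - (b * x₀)) ≡⟨ interchange u₀ w₀ (- (a * x₀)) (- (b * x₀)) ⟩
      (u₀ - a * x₀) + (w₀ - b * x₀)      ∎

  -ᵛ-·-homogeneous : ∀ c a (u x : Vec Carrier m) → c · u -ᵛ (c * a) · x ≡ c · (u -ᵛ a · x)
  -ᵛ-·-homogeneous c a []       []       = refl
  -ᵛ-·-homogeneous c a (u₀ ∷ u) (x₀ ∷ x) =
    cong₂ _∷_ scalar (-ᵛ-·-homogeneous c a u x)
    where
    open ≡-Reasoning
    scalar : c * u₀ - (c * a) * x₀ ≡ c * (u₀ - a * x₀)
    scalar = begin
      c * u₀ - (c * a) * x₀      ≡⟨ cong (λ z → c * u₀ - z) (*-assoc c a x₀) ⟩
      c * u₀ - c * (a * x₀)      ≡⟨ cong (c * u₀ +_) (-‿distribʳ-* c (a * x₀)) ⟩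
      c * u₀ + c * - (a * x₀)    ≡⟨ sym (distribˡ c u₀ (- (a * x₀))) ⟩
      c * (u₀ - a * x₀)          ∎

  +ᵛ-·-split : ∀ a (u x : Vec Carrier m) → u ≡ a · x +ᵛ (u -ᵛ a · x)
  +ᵛ-·-split a []       []       = refl
  +ᵛ-·-split a (u₀ ∷ u) (x₀ ∷ x) =
    cong₂ _∷_ (sym (trans (sym (+-assoc _ u₀ _)) (xyx⁻¹≈y (a * x₀) u₀))) (+ᵛ-·-split a u x)

  -ᵛ-1·-self : (x : Vec Carrier m) → x -ᵛ 1# · x ≡ 0ᵛ
  -ᵛ-1·-self []      = refl
  -ᵛ-1·-self (x₀ ∷ x) =
    cong₂ _∷_ (trans (cong (λ z → x₀ - z) (*-identityˡ x₀)) (-‿inverseʳ x₀)) (-ᵛ-1·-self x)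

  -ᵛ-0· : (u x : Vec Carrier m) → u -ᵛ 0# · x ≡ u
  -ᵛ-0· []       []       = refl
  -ᵛ-0· (u₀ ∷ u) (x₀ ∷ x) =
    cong₂ _∷_ (trans (cong (λ z → u₀ - z) (zeroˡ x₀)) (trans (cong (u₀ +_) -0#≈0#) (+-identityʳ u₀)))
              (-ᵛ-0· u x)

  lincomb-cong : (c : Fin k → Carrier) {u w : Fin k → Vec Carrier m} →
                 (∀ i → u i ≡ w i) → lincomb F c u ≡ lincomb F c w
  lincomb-cong {k = zero}  c u≗w = refl
  lincomb-cong {k = suc k} c u≗w =
    cong₂ _+ᵛ_ (cong (c zero ·_) (u≗w zero)) (lincomb-cong (λ i → c (suc i)) (λ i → u≗w (suc i)))

  lincomb-zero : {c : Fin k → Carrier} (u : Fin k → Vec Carrier m) →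
                 (∀ i → c i ≡ 0#) → lincomb F c u ≡ 0ᵛ
  lincomb-zero {k = zero}      u c≗0 = refl
  lincomb-zero {k = suc k} {c = c} u c≗0 = begin
    c zero · u zero +ᵛ lincomb F (λ i → c (suc i)) (λ i → u (suc i))
      ≡⟨ cong₂ _+ᵛ_ (trans (cong (_· u zero) (c≗0 zero)) (·-zeroˡ (u zero)))
                    (lincomb-zero (λ i → u (suc i)) (λ i → c≗0 (suc i))) ⟩
    0ᵛ +ᵛ 0ᵛ ≡⟨ +ᵛ-identityʳ 0ᵛ ⟩
    0ᵛ ∎
    where open ≡-Reasoning

  ·-lincomb : ∀ a (c : Fin k → Carrier) (u : Fin k → Vec Carrier m) →
              a · lincomb F c u ≡ lincomb F (λ i → a * c i) u
  ·-lincomb {k = zero}  a c u = ·-zeroʳ a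
  ·-lincomb {k = suc k} a c u =
    trans (·-distribˡ-+ᵛ a _ _)
          (cong₂ _+ᵛ_ (·-assoc a (c zero) (u zero)) (·-lincomb a (λ i → c (suc i)) (λ i → u (suc i))))

  record IsLinear (f : Vec Carrier m → Vec Carrier n) : Set where
    field
      additive    : ∀ u w → f (u +ᵛ w) ≡ f u +ᵛ f w
      homogeneous : ∀ a u → f (a · u) ≡ a · f u

  module _ {f : Vec Carrier m → Vec Carrier n} (linear : IsLinear f) where
    open IsLinear linear

    linear-0ᵛ : f 0ᵛ ≡ 0ᵛ
    linear-0ᵛ = begin
      f 0ᵛ         ≡⟨ cong f (sym (·-zeroˡ 0ᵛ)) ⟩
      f (0# · 0ᵛ)  ≡⟨ homogeneous 0# 0ᵛ ⟩
      0# · f 0ᵛ    ≡⟨ ·-zeroˡ (f 0ᵛ) ⟩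
      0ᵛ           ∎
      where open ≡-Reasoning

    linear-lincomb : (c : Fin k → Carrier) (u : Fin k → Vec Carrier m) →
                     f (lincomb F c u) ≡ lincomb F c (λ i → f (u i))
    linear-lincomb {k = zero}  c u = linear-0ᵛ
    linear-lincomb {k = suc k} c u =
      trans (additive _ _)
            (cong₂ _+ᵛ_ (homogeneous (c zero) (u zero)) (linear-lincomb (λ i → c (suc i)) (λ i → u (suc i))))

  infix 4 _∈Subspace_
  _∈Subspace_ : Vec Carrier m → Subspace F m k → Set
  v ∈Subspace L = ∃[ c ] (v ≡ lincomb F c (Subspace.basis L))

  ∈Subspace-· : ∀ {L : Subspace F m k} a {v} → v ∈Subspace L → a · v ∈Subspace L
  ∈Subspace-· {L = L} a (c , refl) = (λ i → a * c i) , ·-lincomb a c (Subspace.basis L)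

  ≟-sound : {x y : Carrier} → T (does (x ≟ y)) → x ≡ y
  ≟-sound {x} {y} t with x ≟ y
  ... | yes x≡y = x≡y

  ≟-refl : {x : Carrier} → T (does (x ≟ x))
  ≟-refl {x} with x ≟ x
  ... | yes _   = tt
  ... | no x≢x = x≢x refl

  IsNormalized : Vec Carrier m → Set
  IsNormalized v = T (normalized F v)

  0∷-normalized : {v : Vec Carrier m} → IsNormalized v → IsNormalized (0# ∷ v)
  0∷-normalized v-nrm with 0# ≟ 0#
  ... | yes _   = v-nrm
  ... | no 0≢0 = ⊥-elim (0≢0 refl)

  1∷-normalized : (v : Vec Carrier m) → IsNormalized (1# ∷ v)
  1∷-normalized v with 1# ≟ 0#
  ... | yes 1≡0 = ⊥-elim (0≢1 (sym 1≡0))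
  ... | no _    = ≟-refl

  singleton-normalized : ∀ {a} → IsNormalized (a ∷ []) → a ≡ 1#
  singleton-normalized {a} a-nrm with a ≟ 0#
  ... | no _ = ≟-sound a-nrm

  normalized-·≡0ᵛ : ∀ a {x : Vec Carrier m} → IsNormalized x → a · x ≡ 0ᵛ → a ≡ 0#
  normalized-·≡0ᵛ a {x₀ ∷ x} x-nrm ax≡0 with x₀ ≟ 0#
  ... | yes _ = normalized-·≡0ᵛ a x-nrm (cong tail ax≡0)
  ... | no _  = begin
    a           ≡⟨ sym (*-identityʳ a) ⟩
    a * 1#      ≡⟨ cong (a *_) (sym (≟-sound x-nrm)) ⟩
    a * x₀      ≡⟨ cong head ax≡0 ⟩
    0#          ∎
    where open ≡-Reasoning

  -- The zero vector is sent to the junk point (0, …, 0, 1), with scalar 0 in normalize-scalar.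
  normalize : Vec Carrier (suc m) → Vec Carrier (suc m)
  normalize {zero}  _       = 1# ∷ []
  normalize {suc m} (a ∷ v) with a ≟ 0#
  ... | yes _   = 0# ∷ normalize v
  ... | no a≢0 = 1# ∷ proj₁ (inverse a a≢0) · v

  normalize-normalized : (v : Vec Carrier (suc m)) → IsNormalized (normalize v)
  normalize-normalized {zero}  _       = 1∷-normalized []
  normalize-normalized {suc m} (a ∷ v) with a ≟ 0#
  ... | yes _ = 0∷-normalized (normalize-normalized v)
  ... | no _  = 1∷-normalized _

  normalize-scalar : (v : Vec Carrier (suc m)) → ∃[ μ ] (v ≡ μ · normalize v)
  normalize-scalar {zero}  (a ∷ []) = a , cong (_∷ []) (sym (*-identityʳ a))
  normalize-scalar {suc m} (a ∷ v) with a ≟ 0#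
  ... | yes a≡0 = let μ , v≡μw = normalize-scalar v in
                  μ , cong₂ _∷_ (trans a≡0 (sym (zeroʳ μ))) v≡μw
  ... | no a≢0  = let a⁻¹ , aa⁻¹≡1 = inverse a a≢0 in
                  a , cong₂ _∷_ (sym (*-identityʳ a)) (sym (begin
                    a · a⁻¹ · v      ≡⟨ ·-assoc a a⁻¹ v ⟩
                    (a * a⁻¹) · v    ≡⟨ cong (_· v) aa⁻¹≡1 ⟩
                    1# · v           ≡⟨ ·-identityˡ v ⟩
                    v                ∎))
    where open ≡-Reasoning

  -- For normalized x with pivot p (its first nonzero coordinate, which is 1), `project x v` clears
  -- coordinate p of v by subtracting a multiple of x and then drops it, and `section x` reinserts p as 0;
  -- so F^(m+1) = F x ⊕ section x (F^m), and `project x` is the projection from x onto F_q P^(m-1).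
  project : Vec Carrier (suc m) → Vec Carrier (suc m) → Vec Carrier m
  project {zero}  _        _        = []
  project {suc m} (x₀ ∷ x) v with x₀ ≟ 0#
  ... | yes _ = head v ∷ project x (tail v)
  ... | no _  = tail v -ᵛ head v · x

  section : Vec Carrier (suc m) → Vec Carrier m → Vec Carrier (suc m)
  section {zero}  _        []       = 0# ∷ []
  section {suc m} (x₀ ∷ x) b with x₀ ≟ 0#
  ... | yes _ = head b ∷ section x (tail b)
  ... | no _  = 0# ∷ b

  project-linear : (x : Vec Carrier (suc m)) → IsLinear (project x)
  project-linear x = record { additive = additive x ; homogeneous = homogeneous x }
    where
    additive : ∀ {m} (x : Vec Carrier (suc m)) u w → project x (u +ᵛ w) ≡ project x u +ᵛ project x w
    additive {zero}  _        _        _        = refl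
    additive {suc m} (x₀ ∷ x) (u₀ ∷ u) (w₀ ∷ w) with x₀ ≟ 0#
    ... | yes _ = cong (u₀ + w₀ ∷_) (additive x u w)
    ... | no _  = -ᵛ-·-additive u₀ w₀ u w x
    homogeneous : ∀ {m} (x : Vec Carrier (suc m)) a u → project x (a · u) ≡ a · project x u
    homogeneous {zero}  _        _ _        = refl
    homogeneous {suc m} (x₀ ∷ x) a (u₀ ∷ u) with x₀ ≟ 0#
    ... | yes _ = cong (a * u₀ ∷_) (homogeneous x a u)
    ... | no _  = -ᵛ-·-homogeneous a u₀ u x

  section-linear : (x : Vec Carrier (suc m)) → IsLinear (section x)
  section-linear x = record { additive = additive x ; homogeneous = homogeneous x }
    where
    additive : ∀ {m} (x : Vec Carrier (suc m)) u w → section x (u +ᵛ w) ≡ section x u +ᵛ section x w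
    additive {zero}  _        []       []       = cong (_∷ []) (sym (+-identityʳ 0#))
    additive {suc m} (x₀ ∷ x) (u₀ ∷ u) (w₀ ∷ w) with x₀ ≟ 0#
    ... | yes _ = cong (u₀ + w₀ ∷_) (additive x u w)
    ... | no _  = cong (_∷ (u₀ + w₀ ∷ u +ᵛ w)) (sym (+-identityʳ 0#))
    homogeneous : ∀ {m} (x : Vec Carrier (suc m)) a u → section x (a · u) ≡ a · section x u
    homogeneous {zero}  _        a []       = cong (_∷ []) (sym (zeroʳ a))
    homogeneous {suc m} (x₀ ∷ x) a (u₀ ∷ u) with x₀ ≟ 0#
    ... | yes _ = cong (a * u₀ ∷_) (homogeneous x a u)
    ... | no _  = cong (_∷ a · (u₀ ∷ u)) (sym (zeroʳ a))

  project-section : (x : Vec Carrier (suc m)) (b : Vec Carrier m) → project x (section x b) ≡ b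
  project-section {zero}  _        []       = refl
  project-section {suc m} (x₀ ∷ x) (b₀ ∷ b) with x₀ ≟ 0#
  ... | yes _ = cong (b₀ ∷_) (project-section x b)
  ... | no _  = -ᵛ-0· (b₀ ∷ b) x

  project-self : (x : Vec Carrier (suc m)) → IsNormalized x → project x x ≡ 0ᵛ
  project-self {zero}  _        _ = refl
  project-self {suc m} (x₀ ∷ x) x-nrm with x₀ ≟ 0#
  ... | yes x₀≡0 = cong₂ _∷_ x₀≡0 (project-self x x-nrm)
  ... | no _     = trans (cong (λ a → x -ᵛ a · x) (≟-sound x-nrm)) (-ᵛ-1·-self x)

  x≡x*y+0 : ∀ x {y} → y ≡ 1# → x ≡ x * y + 0#
  x≡x*y+0 x refl = sym (trans (+-identityʳ (x * 1#)) (*-identityʳ x))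

  z≡x*y+z : ∀ x {y} z → y ≡ 0# → z ≡ x * y + z
  z≡x*y+z x z refl = sym (trans (cong (_+ z) (zeroʳ x)) (+-identityˡ z))

  project-decomposition : (x : Vec Carrier (suc m)) → IsNormalized x →
                          ∀ v → ∃[ a ] (v ≡ a · x +ᵛ section x (project x v))
  project-decomposition {zero} (x₀ ∷ []) x-nrm (v₀ ∷ []) =
    v₀ , cong (_∷ []) (x≡x*y+0 v₀ (singleton-normalized x-nrm))
  project-decomposition {suc m} (x₀ ∷ x) x-nrm (v₀ ∷ v) with x₀ ≟ 0#
  ... | yes x₀≡0 = let a , v≡ = project-decomposition x x-nrm v in
                   a , cong₂ _∷_ (z≡x*y+z a v₀ x₀≡0) v≡
  ... | no _     = v₀ , cong₂ _∷_ (x≡x*y+0 v₀ (≟-sound x-nrm)) (+ᵛ-·-split v₀ v x)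

  join : Point F (suc k) → Subspace F (suc k) k → Subspace F (suc (suc k)) (suc k)
  join {k} (x , x-nrm) L = record { basis = basis ; indep = indep }
    where
    b = Subspace.basis L
    basis : Fin (suc k) → Vec Carrier (suc (suc k))
    basis zero    = x
    basis (suc i) = section x (b i)

    indep : LinearlyIndependent F basis
    indep c lincomb≡0 = coefficients≡0
      where
      open ≡-Reasoning
      c′ = λ i → c (suc i)
      rest = lincomb F c′ (λ i → section x (b i))

      rest-coefficients≡0 : ∀ i → c′ i ≡ 0#
      rest-coefficients≡0 = Subspace.indep L c′ (begin
        lincomb F c′ b                           ≡⟨ lincomb-cong c′ (λ i → project-section x (b i)) ⟨
        projected-rest                           ≡⟨ +ᵛ-identityˡ projected-rest ⟨
        0ᵛ +ᵛ projected-rest                     ≡⟨ cong (_+ᵛ projected-rest) c₀x↦0 ⟨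
        lincomb F c (λ i → project x (basis i))  ≡⟨ linear-lincomb (project-linear x) c basis ⟨
        project x (lincomb F c basis)            ≡⟨ cong (project x) lincomb≡0 ⟩
        project x 0ᵛ                             ≡⟨ linear-0ᵛ (project-linear x) ⟩
        0ᵛ                                       ∎)
        where
        projected-rest = lincomb F c′ (λ i → project x (section x (b i)))
        c₀x↦0 : c zero · project x x ≡ 0ᵛ
        c₀x↦0 = trans (cong (c zero ·_) (project-self x x-nrm)) (·-zeroʳ (c zero))

      point-coefficient≡0 : c zero ≡ 0#
      point-coefficient≡0 = normalized-·≡0ᵛ (c zero) x-nrm (begin
        c zero · x                ≡⟨ +ᵛ-identityʳ _ ⟨
        c zero · x +ᵛ 0ᵛ          ≡⟨ cong (c zero · x +ᵛ_) (lincomb-zero _ rest-coefficients≡0) ⟨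
        c zero · x +ᵛ rest        ≡⟨ lincomb≡0 ⟩
        0ᵛ                        ∎)

      coefficients≡0 : ∀ i → c i ≡ 0#
      coefficients≡0 zero    = point-coefficient≡0
      coefficients≡0 (suc i) = rest-coefficients≡0 i

  point∈join : (x : Point F (suc k)) (L : Subspace F (suc k) k) → proj₁ x ∈Subspace join x L
  point∈join (x , _) L = 1# Coefficients.∷ (λ _ → 0#) , sym (begin
    1# · x +ᵛ lincomb F (λ _ → 0#) sections
      ≡⟨ cong₂ _+ᵛ_ (·-identityˡ x) (lincomb-zero sections (λ _ → refl)) ⟩
    x +ᵛ 0ᵛ ≡⟨ +ᵛ-identityʳ x ⟩
    x       ∎)
    where
    open ≡-Reasoning
    sections = λ i → section x (Subspace.basis L i)

  projectPoint : Point F (suc k) → Point F (suc k) → Point F k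
  projectPoint (x , _) (y , _) = normalize (project x y) , normalize-normalized (project x y)

  ∈join : (x y : Point F (suc k)) (L : Subspace F (suc k) k) →
          proj₁ (projectPoint x y) ∈Subspace L → proj₁ y ∈Subspace join x L
  ∈join (x , x-nrm) (y , _) L py∈L =
    let a , y≡ = project-decomposition x x-nrm y
        μ , py≡ = normalize-scalar (project x y)
        c , μpy≡ = ∈Subspace-· {L = L} μ py∈L
    in a Coefficients.∷ c , (begin
      y ≡⟨ y≡ ⟩
      a · x +ᵛ section x (project x y)
        ≡⟨ cong (λ v → a · x +ᵛ section x v) (trans py≡ μpy≡) ⟩
      a · x +ᵛ section x (lincomb F c (Subspace.basis L))
        ≡⟨ cong (a · x +ᵛ_) (linear-lincomb (section-linear x) c (Subspace.basis L)) ⟩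
      a · x +ᵛ lincomb F c (λ i → section x (Subspace.basis L i)) ∎)
    where open ≡-Reasoning

  Point-≡ : {x y : Point F k} → proj₁ x ≡ proj₁ y → x ≡ y
  Point-≡ {x = v , _} refl = cong (v ,_) (T-irrelevant _ _)

  splitPoint : (a : Carrier) (v : Vec Carrier (suc k)) → IsNormalized (a ∷ v) → Vec Carrier (suc k) ⊎ Point F k
  splitPoint a v a∷v-nrm with a ≟ 0#
  ... | yes _ = inj₂ (v , a∷v-nrm)
  ... | no _  = inj₁ v

  joinPoint : Vec Carrier (suc k) ⊎ Point F k → Point F (suc k)
  joinPoint (inj₁ v)           = 1# ∷ v , 1∷-normalized v
  joinPoint (inj₂ (v , v-nrm)) = 0# ∷ v , 0∷-normalized v-nrm

  joinPoint-splitPoint : ∀ a (v : Vec Carrier (suc k)) (a∷v-nrm : IsNormalized (a ∷ v)) →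
                         proj₁ (joinPoint (splitPoint a v a∷v-nrm)) ≡ a ∷ v
  joinPoint-splitPoint a v a∷v-nrm with a ≟ 0#
  ... | yes a≡0 = cong (_∷ v) (sym a≡0)
  ... | no _    = cong (_∷ v) (sym (≟-sound a∷v-nrm))

  Vec↔Fin : ∀ m → Vec Carrier m ↔ Fin (q Nat.^ m)
  Vec↔Fin m = ↔-sym (Fin[m^n]↔Fin[m]^n q m) ↔-∘ (lift↔ m card ↔-∘ ↔-sym (↔Vec m))

  Point↪Vec⊎Point : Point F (suc k) ↪ (Vec Carrier (suc k) ⊎ Point F k)
  Point↪Vec⊎Point = mk↪ {to = λ { (a ∷ v , a∷v-nrm) → splitPoint a v a∷v-nrm }} {from = joinPoint}
    λ { {a ∷ v , a∷v-nrm} refl → Point-≡ (joinPoint-splitPoint a v a∷v-nrm) }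

  Point↪Fin : ∀ k → Point F k ↪ Fin (pointCount q k)
  Point↪Fin zero    = mk↪ {to = λ _ → zero} {from = λ _ → 1# ∷ [] , 1∷-normalized []}
    λ { {a ∷ [] , a-nrm} _ → Point-≡ (cong (_∷ []) (sym (singleton-normalized a-nrm))) }
  Point↪Fin (suc k) =
    ↔⇒↪ (↔-sym +↔⊎) ↪-∘ ((↔⇒↪ (Vec↔Fin (suc k)) ⊎-↪ Point↪Fin k) ↪-∘ Point↪Vec⊎Point)

  record HyperplanePartition (I : Set) (m : ℕ) : Set₁ where
    field
      partition       : ProductPartition I (Point F m) m
      hyperplane      : I → Subspace F (suc m) m
      part⊆hyperplane : ∀ i x → x ∈Π ProductPartition.part partition i →
                        ∀ j → proj₁ (x j) ∈Subspace hyperplane i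

  reindexHyperplanes : {I J : Set} → I ↔ J → HyperplanePartition I m → HyperplanePartition J m
  reindexHyperplanes I↔J H = record
    { partition       = reindex I↔J partition
    ; hyperplane      = λ j → hyperplane (Inverse.from I↔J j)
    ; part⊆hyperplane = λ j → part⊆hyperplane (Inverse.from I↔J j)
    }
    where open HyperplanePartition H

  hyperplanePartition : ∀ m → HyperplanePartition (Fin (partCount q m)) m
  hyperplanePartition zero = record
    { partition       = trivialPartition
    ; hyperplane      = λ _ → record { basis = λ () ; indep = λ _ _ () }
    ; part⊆hyperplane = λ _ _ _ ()
    }
  hyperplanePartition (suc k) = reindexHyperplanes (↔-sym *↔×) (record
    { partition       = extend encode π P.partition
    ; hyperplane      = λ (a , i) → join (decode a) (P.hyperplane i)
    ; part⊆hyperplane = λ (a , i) → part⊆hyperplane a i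
    })
    where
    module P = HyperplanePartition (hyperplanePartition k)
    open RightInverse (Point↪Fin (suc k)) renaming (to to encode; from to decode)

    π : Fin (pointCount q (suc k)) → Point F (suc k) → Point F k
    π a = projectPoint (decode a)

    part⊆hyperplane : ∀ a i x → x ∈Π ProductPartition.part (extend encode π P.partition) (a , i) →
                      ∀ j → proj₁ (x j) ∈Subspace join (decode a) (P.hyperplane i)
    part⊆hyperplane a i x x∈ zero =
      subst (λ x₀ → proj₁ x₀ ∈Subspace join (decode a) (P.hyperplane i))
            (inverseʳ (sym (x∈ zero))) (point∈join (decode a) (P.hyperplane i))
    part⊆hyperplane a i x x∈ (suc j) =
      ∈join (decode a) (x (suc j)) (P.hyperplane i)
            (P.part⊆hyperplane i (λ j → π a (x (suc j))) (λ j → x∈ (suc j)) j)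

open Nat using (_≤_; _*_; _+_; _^_; _∸_)
open import Data.Nat.DivMod using (_/_)
open import Data.Nat.Properties using (≤-trans; *-monoʳ-≤)

theorem1p2 : ∃[ C ] (1 ≤ C × ((n : ℕ) → 1 ≤ n → (q : ℕ) → IsPrimePower q → 2 * n ≤ q → (F : FiniteField q) →
    ∃[ N ] Σ (Fin N → Fin n → Point F n → Set) (λ A → Σ (Fin N → Flat F n (n ∸ 1)) (λ L →
    ((x : Fin n → Point F n) → ∃[ i ] (((j : Fin n) → A i j (x j)) × ((i′ : Fin N) → ((j : Fin n) → A i′ j (x j)) → i′ ≡ i)))
    × ((i : Fin N) (x : Fin n → Point F n) → ((j : Fin n) → A i j (x j)) → (j : Fin n) → _∈Flat_ F (x j) (L i))
    × N * q ≤ q ^ ((n * (n + 1)) / 2) * (q + C * n)))))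
theorem1p2 = 4 , s≤s z≤n , λ where
  n@(suc _) (s≤s z≤n) q _ 2n≤q F →
    let open HyperplanePartition (hyperplanePartition F n)
        open ProductPartition partition
        2≤q = ≤-trans (*-monoʳ-≤ 2 (s≤s z≤n)) 2n≤q
    in partCount q n , part , hyperplane , classify , part⊆hyperplane ,
       subst (λ e → partCount q n * q ≤ q ^ e * (q + 4 * n)) (sym (n*[n+1]/2≡triangular n))
             (partCount-bound q n 2≤q 2n≤q)
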